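{- Suppose a DTS$(v)$ $(X,\mathcal{B})$ with $\{0,1,\dots,8\}\subseteq X$ contains the following twelve triples: $(1,2,3), (4,3,2), (3,4,5), (6,5,4), (5,6,2), (7,2,6), (2,7,8), (3,8,7), (8,3,6), (2,1,0), (6,0,1), (0,6,3)$. Then the DTS$(v)$ does not have a $v$-good sequencing.
   Context: A transitive triple is an ordered triple $(x,y,z)$ of distinct elements; it contains the directed edges $(x,y)$, $(x,z)$, $(y,z)$. A directed triple system of order $v$, DTS$(v)$, is a pair $(X,\mathcal{B})$ where $X$ is a set of $v$ points and $\mathcal{B}$ is a set of transitive triples of elements of $X$ such that every ordered pair $(a,b)$ of distinct points of $X$ occurs as a directed edge in exactly one triple of $\mathcal{B}$. A $v$-good sequencing of a DTS$(v)$ $(X,\mathcal{B})$ is a permutation $[x_1\, x_2\, \cdots\, x_v]$ of $X$ such that for no triple $(x,y,z)\in\mathcal{B}$ do we have $x=x_i$, $y=x_j$, $z=x_k$ with $i<j<k$. -}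

module Defs where

open import Data.Nat using (ℕ)
open import Data.Empty using (⊥)
open import Data.Fin using (Fin; _<_)
open import Data.Product using (_×_; _,_; ∃; Σ-syntax)
open import Data.List using (List)
open import Data.List.Membership.Propositional using (_∈_)
open import Relation.Binary.PropositionalEquality using (_≡_; _≢_)
open import Function.Bundles using (_⤖_; Bijection)

record TTriple (X : Set) : Set where
  constructor ⟨_,_,_⟩
  field
    fst snd thd : X
open TTriple public

Distinct3 : {X : Set} → TTriple X → Set
Distinct3 t = (fst t ≢ snd t) × (fst t ≢ thd t) × (snd t ≢ thd t)

data HasEdge {X : Set} : TTriple X → X → X → Set where
  e₁₂ : ∀ {x y z} → HasEdge ⟨ x , y , z ⟩ x y
  e₁₃ : ∀ {x y z} → HasEdge ⟨ x , y , z ⟩ x z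
  e₂₃ : ∀ {x y z} → HasEdge ⟨ x , y , z ⟩ y z

record IsDTS (v : ℕ) (B : List (TTriple (Fin v))) : Set where
  field
    distinct : ∀ {t} → t ∈ B → Distinct3 t
    covered  : ∀ a b → a ≢ b → ∃ λ t → (t ∈ B) × HasEdge t a b
    unique   : ∀ {a b t t′} → t ∈ B → t′ ∈ B →
               HasEdge t a b → HasEdge t′ a b → t ≡ t′

-- A v-good sequencing: a permutation [x₁ ⋯ x_v] of the points, given as a
-- bijection from positions Fin v to points, such that no triple (x,y,z) ∈ B
-- has x = x_i, y = x_j, z = x_k with i < j < k.
GoodSequencing : (v : ℕ) → List (TTriple (Fin v)) → Set
GoodSequencing v B =
  Σ[ σ ∈ Fin v ⤖ Fin v ]
    (∀ {i j k} → i < j → j < k →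
       ⟨ Bijection.to σ i , Bijection.to σ j , Bijection.to σ k ⟩ ∈ B →
       ⊥)

-- Read positions in a good sequencing as a strict total order: each triple
-- (x,y,z) then forbids x < y < z, so whenever two of its points are ordered
-- one way, the third point is forced to one side.  Starting from the relative
-- order of 2 and 3, these forcings propagate around the twelve triples: if
-- 3 < 2 they force 2 < 6 < 3, and if 2 < 3 they force 3 < 6 < 2; either way
-- the order contains a 3-cycle.
module Submission where

open import Defs
open import Data.Nat using (ℕ)
open import Data.Fin using (Fin; #_; _≟_)
open import Data.Fin.Properties using (<-strictTotalOrder)
open import Data.List using (List; []; _∷_)
open import Data.List.Membership.Propositional using (_∈_)
open import Data.List.Relation.Unary.All using (All; []; _∷_)
open import Data.Empty using (⊥; ⊥-elim)
open import Data.Sum using (_⊎_; inj₁; inj₂; [_,_]′)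
open import Data.Product using (_×_; _,_)
open import Function.Bundles using (_⤖_; Bijection; Surjection)
open import Function.Definitions using (Injective)
open import Relation.Binary using (Rel; StrictTotalOrder; tri<; tri≈; tri>)
open import Relation.Binary.PropositionalEquality using (_≡_; _≢_; refl; sym; cong; subst; module ≡-Reasoning)
open import Relation.Nullary using (¬_)
open import Relation.Nullary.Decidable using (False; toWitnessFalse)

Avoids : ∀ {a ℓ} {X : Set} {A : Set a} → Rel A ℓ → (X → A) → TTriple X → Set ℓ
Avoids _<_ f t = ¬ (f (fst t) < f (snd t) × f (snd t) < f (thd t))

module _ {A B : Set} (σ : A ⤖ B) where
  open Bijection σ using (to; to⁻; surjection)

  to∘to⁻ : ∀ x → to (to⁻ x) ≡ x
  to∘to⁻ = Surjection.to∘to⁻ surjection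

  to⁻-injective : Injective _≡_ _≡_ to⁻
  to⁻-injective {x} {y} eq = begin
    x            ≡⟨ to∘to⁻ x ⟨
    to (to⁻ x)   ≡⟨ cong to eq ⟩
    to (to⁻ y)   ≡⟨ to∘to⁻ y ⟩
    y            ∎
    where open ≡-Reasoning

module _ {v : ℕ} {B : List (TTriple (Fin v))} where
  open StrictTotalOrder (<-strictTotalOrder v) using (_<_)

  -- σ maps positions to points, so the position of a point is its preimage.
  goodSequencing-avoids : ((σ , _) : GoodSequencing v B) →
                          ∀ {t} → t ∈ B → Avoids _<_ (Bijection.to⁻ σ) t
  goodSequencing-avoids (σ , good) {⟨ x , y , z ⟩} t∈B (i<j , j<k) =
    good i<j j<k (subst (_∈ B) (sym (cong₃ (to∘to⁻ σ x) (to∘to⁻ σ y) (to∘to⁻ σ z))) t∈B)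
    where
    cong₃ : ∀ {x x′ y y′ z z′ : Fin v} → x ≡ x′ → y ≡ y′ → z ≡ z′ →
            ⟨ x , y , z ⟩ ≡ ⟨ x′ , y′ , z′ ⟩
    cong₃ refl refl refl = refl

module InjectiveLabelling {a ℓ₁ ℓ₂} (O : StrictTotalOrder a ℓ₁ ℓ₂) {n : ℕ}
         {q : Fin n → StrictTotalOrder.Carrier O}
         (q-injective : Injective _≡_ (StrictTotalOrder._≈_ O) q) where
  open StrictTotalOrder O using (_<_; compare; irrefl; trans; module Eq)

  <-connex-injective : ∀ {i j} → i ≢ j → q i < q j ⊎ q j < q i
  <-connex-injective {i} {j} i≢j with compare (q i) (q j)
  ... | tri< qi<qj _ _ = inj₁ qi<qj
  ... | tri≈ _ qi≈qj _ = ⊥-elim (i≢j (q-injective qi≈qj))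
  ... | tri> _ _ qj<qi = inj₂ qj<qi

  avoids-x<y⇒z<y : ∀ {i j k} {j≢k : False (j ≟ k)} → Avoids _<_ q ⟨ i , j , k ⟩ →
                   q i < q j → q k < q j
  avoids-x<y⇒z<y {j≢k = j≢k} avoids qi<qj =
    [ (λ qj<qk → ⊥-elim (avoids (qi<qj , qj<qk))) , (λ qk<qj → qk<qj) ]′
      (<-connex-injective (toWitnessFalse j≢k))

  avoids-y<z⇒y<x : ∀ {i j k} {i≢j : False (i ≟ j)} → Avoids _<_ q ⟨ i , j , k ⟩ →
                   q j < q k → q j < q i
  avoids-y<z⇒y<x {i≢j = i≢j} avoids qj<qk =
    [ (λ qi<qj → ⊥-elim (avoids (qi<qj , qj<qk))) , (λ qj<qi → qj<qi) ]′
      (<-connex-injective (toWitnessFalse i≢j))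

  <-acyclic₃ : ∀ {x y z} → x < y → y < z → z < x → ⊥
  <-acyclic₃ x<y y<z z<x = irrefl Eq.refl (trans x<y (trans y<z z<x))

configuration : List (TTriple (Fin 9))
configuration =
  ⟨ # 1 , # 2 , # 3 ⟩ ∷ ⟨ # 4 , # 3 , # 2 ⟩ ∷ ⟨ # 3 , # 4 , # 5 ⟩ ∷
  ⟨ # 6 , # 5 , # 4 ⟩ ∷ ⟨ # 5 , # 6 , # 2 ⟩ ∷ ⟨ # 7 , # 2 , # 6 ⟩ ∷
  ⟨ # 2 , # 7 , # 8 ⟩ ∷ ⟨ # 3 , # 8 , # 7 ⟩ ∷ ⟨ # 8 , # 3 , # 6 ⟩ ∷
  ⟨ # 2 , # 1 , # 0 ⟩ ∷ ⟨ # 6 , # 0 , # 1 ⟩ ∷ ⟨ # 0 , # 6 , # 3 ⟩ ∷ []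

configuration-unavoidable :
  ∀ {a ℓ₁ ℓ₂} (O : StrictTotalOrder a ℓ₁ ℓ₂) {q : Fin 9 → StrictTotalOrder.Carrier O} →
  Injective _≡_ (StrictTotalOrder._≈_ O) q →
  ¬ All (Avoids (StrictTotalOrder._<_ O) q) configuration
configuration-unavoidable O {q} q-injective
  (t₁₂₃ ∷ t₄₃₂ ∷ t₃₄₅ ∷ t₆₅₄ ∷ t₅₆₂ ∷ t₇₂₆ ∷ t₂₇₈ ∷ t₃₈₇ ∷ t₈₃₆ ∷ t₂₁₀ ∷ t₆₀₁ ∷ t₀₆₃ ∷ []) =
  [ two-before-three-impossible , three-before-two-impossible ]′
    (<-connex-injective {# 2} {# 3} (λ ()))
  where
  open StrictTotalOrder O using (_<_)
  open InjectiveLabelling O q-injective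

  three-before-two-impossible : q (# 3) < q (# 2) → ⊥
  three-before-two-impossible q₃<q₂ = <-acyclic₃ q₃<q₂ q₂<q₆ q₆<q₃
    where
    q₂<q₆ : q (# 2) < q (# 6)
    q₂<q₆ = avoids-x<y⇒z<y t₅₆₂ (avoids-y<z⇒y<x t₆₅₄
              (avoids-x<y⇒z<y t₃₄₅ (avoids-y<z⇒y<x t₄₃₂ q₃<q₂)))
    q₆<q₃ : q (# 6) < q (# 3)
    q₆<q₃ = avoids-x<y⇒z<y t₈₃₆ (avoids-y<z⇒y<x t₃₈₇
              (avoids-x<y⇒z<y t₂₇₈ (avoids-y<z⇒y<x t₇₂₆ q₂<q₆)))

  two-before-three-impossible : q (# 2) < q (# 3) → ⊥
  two-before-three-impossible q₂<q₃ = <-acyclic₃ q₂<q₃ q₃<q₆ q₆<q₂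
    where
    q₃<q₆ : q (# 3) < q (# 6)
    q₃<q₆ = avoids-x<y⇒z<y t₀₆₃ (avoids-y<z⇒y<x t₆₀₁
              (avoids-x<y⇒z<y t₂₁₀ (avoids-y<z⇒y<x t₁₂₃ q₂<q₃)))
    q₆<q₂ : q (# 6) < q (# 2)
    q₆<q₂ = avoids-x<y⇒z<y t₇₂₆ (avoids-y<z⇒y<x t₂₇₈
              (avoids-x<y⇒z<y t₃₈₇ (avoids-y<z⇒y<x t₈₃₆ q₃<q₆)))

lemma4p2 : (v : ℕ) (B : List (TTriple (Fin v))) → IsDTS v B →
    (p : Fin 9 → Fin v) → Injective _≡_ _≡_ p →
    ⟨ p (# 1) , p (# 2) , p (# 3) ⟩ ∈ B →
    ⟨ p (# 4) , p (# 3) , p (# 2) ⟩ ∈ B →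
    ⟨ p (# 3) , p (# 4) , p (# 5) ⟩ ∈ B →
    ⟨ p (# 6) , p (# 5) , p (# 4) ⟩ ∈ B →
    ⟨ p (# 5) , p (# 6) , p (# 2) ⟩ ∈ B →
    ⟨ p (# 7) , p (# 2) , p (# 6) ⟩ ∈ B →
    ⟨ p (# 2) , p (# 7) , p (# 8) ⟩ ∈ B →
    ⟨ p (# 3) , p (# 8) , p (# 7) ⟩ ∈ B →
    ⟨ p (# 8) , p (# 3) , p (# 6) ⟩ ∈ B →
    ⟨ p (# 2) , p (# 1) , p (# 0) ⟩ ∈ B →
    ⟨ p (# 6) , p (# 0) , p (# 1) ⟩ ∈ B →
    ⟨ p (# 0) , p (# 6) , p (# 3) ⟩ ∈ B →
    ¬ GoodSequencing v B
lemma4p2 v B _ p p-injective m₀ m₁ m₂ m₃ m₄ m₅ m₆ m₇ m₈ m₉ m₁₀ m₁₁ good@(σ , _) =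
  configuration-unavoidable (<-strictTotalOrder v)
    (λ eq → p-injective (to⁻-injective σ eq))
    (avoids m₀ ∷ avoids m₁ ∷ avoids m₂ ∷ avoids m₃ ∷ avoids m₄ ∷ avoids m₅ ∷
     avoids m₆ ∷ avoids m₇ ∷ avoids m₈ ∷ avoids m₉ ∷ avoids m₁₀ ∷ avoids m₁₁ ∷ [])
  where
  open StrictTotalOrder (<-strictTotalOrder v) using (_<_)
  avoids : ∀ {t} → t ∈ B → Avoids _<_ (Bijection.to⁻ σ) t
  avoids = goodSequencing-avoids good
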